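{- For all positive integers $k,l$, $\operatorname{osat}_{\mathcal S}(1,l)=\operatorname{osat}_{\mathcal S}(k,1)=0$, and for integers $k,l\ge 2$, \[\operatorname{osat}_{\mathcal S}(k,l)=\min(2k+l-5,\;2l+k-5).\]
   Context: Sequences consist of distinct real numbers (equivalently, finite planar point sets with pairwise distinct $x$-coordinates and pairwise distinct $y$-coordinates, read in order of $x$-coordinate). A sequence $S$ is $(k,l)$-semisaturated if every sequence $S'$ of distinct reals containing $S$ as a proper subsequence contains an increasing subsequence of length $k$ or a decreasing subsequence of length $l$ that is not entirely contained in $S$. $\operatorname{osat}_{\mathcal S}(k,l)$ is the minimum length of a $(k,l)$-semisaturated sequence.
   Formalization: The sequences, both the semisaturated sequence S and every sequence S' containing it, consist of distinct rationals instead of distinct real numbers. -}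

module Defs where

open import Data.Nat using (ℕ; _≤_; _<_)
open import Data.Rational using (ℚ; _>_) renaming (_<_ to _<ℚ_)
open import Data.List using (List; length)
open import Data.List.Relation.Unary.Any using (Any)
open import Data.List.Relation.Unary.AllPairs using (AllPairs)
open import Data.List.Relation.Binary.Sublist.Propositional using (_⊆_)
open import Data.List.Membership.Propositional using (_∉_)
open import Data.Product using (Σ; _×_)
open import Data.Sum using (_⊎_)
open import Relation.Binary.PropositionalEquality using (_≡_; _≢_)

-- A sequence of distinct numbers.  Only the relative order of the entries
-- matters, so we use the (dense) rationals in place of the reals.
Seq : Set
Seq = List ℚ

Distinct : Seq → Set
Distinct = AllPairs _≢_

Increasing : Seq → Set
Increasing = AllPairs _<ℚ_

Decreasing : Seq → Set
Decreasing = AllPairs _>_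

_⊂_ : Seq → Seq → Set
S ⊂ S' = (S ⊆ S') × (length S < length S')

MonoSub : ℕ → ℕ → Seq → Seq → Set
MonoSub k l S' T = (T ⊆ S') × ((length T ≡ k × Increasing T) ⊎ (length T ≡ l × Decreasing T))

-- (k,l)-semisaturated sequence (entries are distinct; since all entries of
-- an extension are distinct, "not entirely contained in S" means some entry
-- of T is not an entry of S)
Semisaturated : ℕ → ℕ → Seq → Set
Semisaturated k l S =
  Distinct S ×
  ((S' : Seq) → Distinct S' → S ⊂ S' →
     Σ Seq (λ T → MonoSub k l S' T × Any (λ x → x ∉ S) T))

OsatIs : ℕ → ℕ → ℕ → Set
OsatIs k l n =
  Σ Seq (λ S → Semisaturated k l S × length S ≡ n) ×
  ((S : Seq) → Semisaturated k l S → n ≤ length S)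

module Submission where

-- Let A and C be increasing of length k − 2 and B decreasing of length l − 1,
-- with A < B < C.  A new entry x of A ++ B ++ C either lies below an entry b of B that
-- follows it (giving x b C), or above an entry b of B that precedes it (giving A b x), or
-- else it extends B to a decreasing sequence of length l.  So A ++ B ++ C, of length
-- 2k + l − 5, is semisaturated; the mirror image has length 2l + k − 5.
--
-- Call the number of entries of S below a fresh value x its rank.  Put in
-- front of S, x must start an increasing sequence of length k − 1 above it or a decreasing
-- one of length l − 1 below it.  At rank 0 only the first is possible and at rank |S| only
-- the second, so the kind switches between two consecutive ranks i and i + 1; appending
-- at the end gives a similar switch at ranks j and j + 1.  Comparing i with j yields
-- either two increasing sequences of length k − 1 on either side of one fresh value (next
-- to any decreasing one of length l − 1), or the mirror image, or four sequences on either
-- side of one entry of S.  Since an increasing and a decreasing subsequence share at most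
-- one entry, this forces |S| ≥ 2k + l − 5 or |S| ≥ 2l + k − 5.

open import Defs
open import Data.Nat using (ℕ; _≤_; _+_; _*_; _∸_; _⊓_)
open import Data.Product using (_×_)

open import Level using (Level; 0ℓ)
open import Data.Nat using (zero; suc; _<_; z≤n; s≤s)
import Data.Nat.Properties as ℕ
open import Algebra.Properties.CommutativeSemigroup ℕ.+-commutativeSemigroup using (interchange)
open import Data.Nat.Tactic.RingSolver using (solve-∀)
open import Data.Product using (∃-syntax; _,_; proj₁; proj₂)
import Data.Product as Prod
open import Data.Sum using (_⊎_; inj₁; inj₂; swap)
import Data.Sum as Sum
open import Data.Empty using (⊥; ⊥-elim)
open import Function using (id; _∘_; flip)
open import Relation.Nullary using (¬_; yes; no)
open import Relation.Unary using (Pred; Decidable)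
open import Relation.Binary.Core using (Rel)
open import Relation.Binary.Definitions using (tri<; tri≈; tri>)
open import Relation.Binary.Structures using (IsStrictTotalOrder)
open import Relation.Binary.Bundles using (DecTotalOrder)
import Relation.Binary.Construct.Flip.EqAndOrd as Flip
open import Relation.Binary.PropositionalEquality
  using (_≡_; _≢_; refl; sym; trans; cong; cong₂; subst; subst₂; setoid; module ≡-Reasoning)
open import Data.Rational as ℚ using (ℚ; 0ℚ; 1ℚ; -_) renaming (_<_ to _<ℚ_; _≤_ to _≤ℚ_)
import Data.Rational.Properties as ℚ
open import Data.List using (List; []; _∷_; _++_; [_]; filter; length; applyUpTo; applyDownFrom)
import Data.List.Properties as List
open import Data.List.Relation.Unary.All as All using (All; []; _∷_)
import Data.List.Relation.Unary.All.Properties as Allₚ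
open import Data.List.Relation.Unary.Any as Any using (Any; here; there; any?)
import Data.List.Relation.Unary.Any.Properties as Anyₚ
open import Data.List.Relation.Unary.AllPairs as AllPairs using (AllPairs; []; _∷_)
import Data.List.Relation.Unary.AllPairs.Properties as AllPairsₚ
open import Data.List.Membership.Propositional using (_∈_; _∉_; find; lose)
open import Data.List.Membership.Propositional.Properties
  using (∈-filter⁺; ∈-filter⁻; ∈-applyUpTo⁻; ∈-applyDownFrom⁻)
open import Data.List.Relation.Binary.Sublist.Propositional
  using (_⊆_; []; _∷_; _∷ʳ_; ⊆-refl; ⊆-trans; lookup; minimum; from∈)
import Data.List.Relation.Binary.Sublist.Propositional.Properties as Sublist
open import Data.List.Relation.Binary.Permutation.Propositional using (↭-sym)
open import Data.List.Relation.Binary.Permutation.Propositional.Properties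
  using (↭-length; filter-↭; ∈-resp-↭)
import Data.List.Relation.Binary.Permutation.Setoid (setoid ℚ) as Permₛ
open import Data.List.Relation.Binary.Permutation.Setoid.Properties (setoid ℚ) using (Unique-resp-↭)
open import Data.List.Relation.Unary.Sorted.TotalOrder.Properties using (Sorted⇒AllPairs)
open import Data.List.Sort ℚ.≤-decTotalOrder using (sort; sort-↭; sort-↗; SortingAlgorithm; sortingAlgorithm)
open SortingAlgorithm sortingAlgorithm using (sort-↭ₛ)

private
  variable
    a ℓ : Level
    X : Set a

module _ {R : Rel X ℓ} where

  AllPairs-resp-⊆ : ∀ {xs ys} → xs ⊆ ys → AllPairs R ys → AllPairs R xs
  AllPairs-resp-⊆ []         []       = []
  AllPairs-resp-⊆ (y ∷ʳ τ)   (_ ∷ ps) = AllPairs-resp-⊆ τ ps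
  AllPairs-resp-⊆ (refl ∷ τ) (p ∷ ps) = Sublist.All-resp-⊆ τ p ∷ AllPairs-resp-⊆ τ ps

  AllPairs-++⁻ : ∀ xs {ys} → AllPairs R (xs ++ ys) →
                 AllPairs R xs × AllPairs R ys × All (λ x → All (R x) ys) xs
  AllPairs-++⁻ []       ps       = [] , ps , []
  AllPairs-++⁻ (x ∷ xs) (p ∷ ps) with AllPairs-++⁻ xs ps
  ... | xs↑ , ys↑ , xs↑ys = Allₚ.++⁻ˡ xs p ∷ xs↑ , ys↑ , Allₚ.++⁻ʳ xs p ∷ xs↑ys

module _ {P : Pred X ℓ} (P? : Decidable P) where

  ⊆-filter⁺ : ∀ {xs ys} → xs ⊆ ys → All P xs → xs ⊆ filter P? ys
  ⊆-filter⁺ τ ps = subst (_⊆ _) (List.filter-all P? ps) (Sublist.filter⁺ P? P? (λ { refl → id }) τ)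

length-<-sublist : ∀ {xs ys : List X} {y} → xs ⊆ ys → y ∈ ys → y ∉ xs → length xs < length ys
length-<-sublist (z ∷ʳ τ)   _           _   = s≤s (Sublist.length-mono-≤ τ)
length-<-sublist (refl ∷ τ) (here refl) y∉ = ⊥-elim (y∉ (here refl))
length-<-sublist (refl ∷ τ) (there y∈)  y∉ = s≤s (length-<-sublist τ y∈ (y∉ ∘ there))

length-disjoint-sublists : ∀ {xs ys zs : List X} → xs ⊆ zs → ys ⊆ zs →
                           (∀ {w} → w ∈ xs → w ∉ ys) →
                           length xs + length ys ≤ length zs
length-disjoint-sublists [] [] _ = z≤n
length-disjoint-sublists (z ∷ʳ σ) (.z ∷ʳ τ) d = ℕ.m≤n⇒m≤1+n (length-disjoint-sublists σ τ d)
length-disjoint-sublists {xs = xs} {_ ∷ ys} {_ ∷ zs} (z ∷ʳ σ) (refl ∷ τ) d =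
  subst (_≤ suc (length zs)) (sym (ℕ.+-suc (length xs) (length ys)))
        (s≤s (length-disjoint-sublists σ τ (λ w∈xs → d w∈xs ∘ there)))
length-disjoint-sublists (refl ∷ σ) (z ∷ʳ τ) d = s≤s (length-disjoint-sublists σ τ (d ∘ there))
length-disjoint-sublists (refl ∷ σ) (refl ∷ τ) d = ⊥-elim (d (here refl) (here refl))

module _ {R R′ : Rel X ℓ} (R∩R′⇒⊥ : ∀ {x y} → R x y → R′ x y → ⊥) where

  length-opposite-chains : ∀ {xs ys zs} → xs ⊆ zs → ys ⊆ zs → AllPairs R xs → AllPairs R′ ys →
                           length xs + length ys ≤ suc (length zs)
  length-opposite-chains [] [] _ _ = z≤n
  length-opposite-chains (z ∷ʳ σ) (.z ∷ʳ τ) p q = ℕ.m≤n⇒m≤1+n (length-opposite-chains σ τ p q)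
  length-opposite-chains {xs} {_ ∷ ys} {_ ∷ zs} (z ∷ʳ σ) (refl ∷ τ) p (_ ∷ q) =
    subst (_≤ suc (suc (length zs))) (sym (ℕ.+-suc (length xs) (length ys)))
          (s≤s (length-opposite-chains σ τ p q))
  length-opposite-chains (refl ∷ σ) (z ∷ʳ τ) (_ ∷ p) q = s≤s (length-opposite-chains σ τ p q)
  length-opposite-chains {x ∷ xs} {_ ∷ ys} {_ ∷ zs} (refl ∷ σ) (refl ∷ τ) (x≺ ∷ _) (x≺′ ∷ _) =
    subst (_≤ suc (suc (length zs))) (cong suc (sym (ℕ.+-suc (length xs) (length ys))))
          (s≤s (s≤s (length-disjoint-sublists σ τ
            (λ w∈xs w∈ys → R∩R′⇒⊥ (All.lookup x≺ w∈xs) (All.lookup x≺′ w∈ys)))))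

proper-sublist⇒insertion : ∀ {xs ys : List X} → xs ⊆ ys → length xs < length ys →
                           ∃[ xs₁ ] ∃[ y ] ∃[ xs₂ ] xs ≡ xs₁ ++ xs₂ × xs₁ ++ y ∷ xs₂ ⊆ ys
proper-sublist⇒insertion {xs = xs} (y ∷ʳ τ) _ = [] , y , xs , refl , refl ∷ τ
proper-sublist⇒insertion (refl ∷ τ) (s≤s lt) with proper-sublist⇒insertion τ lt
... | xs₁ , y , xs₂ , refl , σ = _ ∷ xs₁ , y , xs₂ , refl , refl ∷ σ

distinct-middle-∉ : ∀ (xs : List X) {y ys} → AllPairs _≢_ (xs ++ y ∷ ys) → y ∉ xs ++ ys
distinct-middle-∉ []       (y≢ ∷ _)  = Allₚ.All¬⇒¬Any y≢
distinct-middle-∉ (_ ∷ xs) (w≢ ∷ _)  (here refl) with Allₚ.++⁻ʳ xs w≢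
... | w≢w ∷ _ = w≢w refl
distinct-middle-∉ (_ ∷ xs) (_ ∷ ds) (there y∈) = distinct-middle-∉ xs ds y∈

⊆-∷ʳ⁻ : ∀ {xs ys : List X} {y} → xs ⊆ ys ++ [ y ] →
        xs ⊆ ys ⊎ ∃[ xs′ ] xs ≡ xs′ ++ [ y ] × xs′ ⊆ ys
⊆-∷ʳ⁻ {ys = []}     (y ∷ʳ [])   = inj₁ []
⊆-∷ʳ⁻ {ys = []}     (refl ∷ []) = inj₂ ([] , refl , [])
⊆-∷ʳ⁻ {ys = w ∷ ys} (w ∷ʳ τ) with ⊆-∷ʳ⁻ τ
... | inj₁ σ                  = inj₁ (w ∷ʳ σ)
... | inj₂ (xs′ , refl , σ)   = inj₂ (xs′ , refl , w ∷ʳ σ)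
⊆-∷ʳ⁻ {ys = w ∷ ys} (refl ∷ τ) with ⊆-∷ʳ⁻ τ
... | inj₁ σ                  = inj₁ (refl ∷ σ)
... | inj₂ (xs′ , refl , σ)   = inj₂ (w ∷ xs′ , refl , refl ∷ σ)

length-∷ʳ : ∀ (xs : List X) {y} → length (xs ++ [ y ]) ≡ suc (length xs)
length-∷ʳ xs {y} = List.length-++-comm xs [ y ]

length-∷ʳ⁻ : ∀ (xs : List X) {y m} → length (xs ++ [ y ]) ≡ suc m → length xs ≡ m
length-∷ʳ⁻ xs eq = ℕ.suc-injective (trans (sym (length-∷ʳ xs)) eq)

chain-∷ʳ⁻ : ∀ {R : Rel X ℓ} xs {y m} → AllPairs R (xs ++ [ y ]) → length (xs ++ [ y ]) ≡ suc m →
            AllPairs R xs × length xs ≡ m × All (λ x → R x y) xs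
chain-∷ʳ⁻ xs xs∷ʳy↑ |xs∷ʳy| with AllPairs-++⁻ xs xs∷ʳy↑
... | xs↑ , _ , xs≺y = xs↑ , length-∷ʳ⁻ xs |xs∷ʳy| , All.map All.head xs≺y

crossing : ∀ (F G : ℕ → Set ℓ) n → (∀ {i} → i ≤ n → F i ⊎ G i) → F 0 → ¬ F n →
           ∃[ i ] i < n × F i × G (suc i)
crossing F G zero    _   F0 ¬Fn = ⊥-elim (¬Fn F0)
crossing F G (suc n) F⊎G F0 ¬Fn with F⊎G {1} (s≤s z≤n)
... | inj₂ G1 = 0 , s≤s z≤n , F0 , G1
... | inj₁ F1 with crossing (F ∘ suc) (G ∘ suc) n (F⊎G ∘ s≤s) F1 ¬Fn
...   | i , i<n , Fi , Gi = suc i , s≤s i<n , Fi , Gi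

-- Ranks of fresh values

p<p+1 : ∀ p → p <ℚ p ℚ.+ 1ℚ
p<p+1 p = subst (_<ℚ p ℚ.+ 1ℚ) (ℚ.+-identityʳ p) (ℚ.+-monoʳ-< p (ℚ.positive⁻¹ 1ℚ))

p-1<p : ∀ p → p ℚ.- 1ℚ <ℚ p
p-1<p p = subst (p ℚ.- 1ℚ <ℚ_) (ℚ.+-identityʳ p) (ℚ.+-monoʳ-< p (ℚ.negative⁻¹ (- 1ℚ)))

≤∧≢⇒< : ∀ {p q} → p ≤ℚ q → p ≢ q → p <ℚ q
≤∧≢⇒< {p} {q} p≤q p≢q with ℚ.<-cmp p q
... | tri< p<q _ _ = p<q
... | tri≈ _ p≡q _ = ⊥-elim (p≢q p≡q)
... | tri> _ _ q<p = ⊥-elim (ℚ.<-irrefl refl (ℚ.≤-<-trans p≤q q<p))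

below above : ℚ → Seq → Seq
below t = filter (ℚ._<? t)
above t = filter (t ℚ.<?_)

length-below+above : ∀ {t} S → t ∉ S → length (below t S) + length (above t S) ≡ length S
length-below+above [] _ = refl
length-below+above {t} (w ∷ S) t∉ with ℚ.<-cmp w t
... | tri≈ _ w≡t _ = ⊥-elim (t∉ (here (sym w≡t)))
... | tri< w<t _ t≮w = begin
  length (below t (w ∷ S)) + length (above t (w ∷ S))
    ≡⟨ cong₂ (λ xs ys → length xs + length ys)
             (List.filter-accept (ℚ._<? t) w<t) (List.filter-reject (t ℚ.<?_) t≮w) ⟩
  suc (length (below t S) + length (above t S))
    ≡⟨ cong suc (length-below+above S (t∉ ∘ there)) ⟩
  suc (length S) ∎
  where open ≡-Reasoning
... | tri> w≮t _ t<w = begin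
  length (below t (w ∷ S)) + length (above t (w ∷ S))
    ≡⟨ cong₂ (λ xs ys → length xs + length ys)
             (List.filter-reject (ℚ._<? t) w≮t) (List.filter-accept (t ℚ.<?_) t<w) ⟩
  length (below t S) + suc (length (above t S))
    ≡⟨ ℕ.+-suc _ _ ⟩
  suc (length (below t S) + length (above t S))
    ≡⟨ cong suc (length-below+above S (t∉ ∘ there)) ⟩
  suc (length S) ∎
  where open ≡-Reasoning

length-below-< : ∀ {S u v z} → z ∈ S → u <ℚ z → z <ℚ v → length (below u S) < length (below v S)
length-below-< {S} {u} {v} z∈S u<z z<v =
  length-<-sublist
    (Sublist.filter⁺ (ℚ._<? u) (ℚ._<? v) (λ { refl w<u → ℚ.<-trans w<u (ℚ.<-trans u<z z<v) }) (⊆-refl {x = S}))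
                   (∈-filter⁺ (ℚ._<? v) z∈S z<v)
                   (λ z∈ → ℚ.<-asym u<z (proj₂ (∈-filter⁻ (ℚ._<? u) {xs = S} z∈)))

strict-lower-bound : ∀ {L} → AllPairs _<ℚ_ L → ∃[ b ] All (b <ℚ_) L
strict-lower-bound {[]}    _        = 0ℚ , []
strict-lower-bound {y ∷ _} (y< ∷ _) = y ℚ.- 1ℚ , p-1<p y ∷ All.map (ℚ.<-trans (p-1<p y)) y<

fresh-of-rank-sorted : ∀ {L b i} → AllPairs _<ℚ_ L → All (b <ℚ_) L → i ≤ length L →
                       ∃[ x ] b <ℚ x × x ∉ L × length (below x L) ≡ i
fresh-of-rank-sorted {[]} {b} _ _ z≤n = b ℚ.+ 1ℚ , p<p+1 b , (λ ()) , refl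
fresh-of-rank-sorted {y ∷ L} {b} {zero} (y< ∷ _) (b<y ∷ _) _ with ℚ.<-dense b<y
... | x , b<x , x<y = x , b<x , x∉ , cong length (List.filter-none (ℚ._<? x) (All.map ℚ.<-asym x<))
  where
  x< : All (x <ℚ_) (y ∷ L)
  x< = x<y ∷ All.map (ℚ.<-trans x<y) y<
  x∉ : x ∉ y ∷ L
  x∉ x∈ = ℚ.<-irrefl refl (All.lookup x< x∈)
fresh-of-rank-sorted {y ∷ L} {b} {suc i} (y< ∷ L↑) (b<y ∷ _) (s≤s i≤) with fresh-of-rank-sorted L↑ y< i≤
... | x , y<x , x∉L , rank =
  x , ℚ.<-trans b<y y<x , x∉ , trans (cong length (List.filter-accept (ℚ._<? x) y<x)) (cong suc rank)
  where
  x∉ : x ∉ y ∷ L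
  x∉ (here refl) = ℚ.<-irrefl refl y<x
  x∉ (there x∈L) = x∉L x∈L

sort-strictlyIncreasing : ∀ {S} → Distinct S → AllPairs _<ℚ_ (sort S)
sort-strictlyIncreasing {S} distinct = AllPairs.zipWith (λ (p≤q , p≢q) → ≤∧≢⇒< p≤q p≢q)
  ( Sorted⇒AllPairs (DecTotalOrder.totalOrder ℚ.≤-decTotalOrder) (sort-↗ S)
  , Unique-resp-↭ (Permₛ.↭-sym (sort-↭ₛ S)) distinct)

fresh-of-rank : ∀ {S i} → Distinct S → i ≤ length S → ∃[ x ] x ∉ S × length (below x S) ≡ i
fresh-of-rank {S} distinct i≤
  with sorted ← sort-strictlyIncreasing distinct
  with b , b< ← strict-lower-bound sorted
  with x , _ , x∉ , rank ← fresh-of-rank-sorted sorted b< (subst (_ ≤_) (sym (↭-length (sort-↭ S))) i≤)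
  = x , x∉ ∘ ∈-resp-↭ (↭-sym (sort-↭ S))
  , trans (↭-length (filter-↭ (ℚ._<? x) (↭-sym (sort-↭ S)))) rank

-- The lower bound

Chain : Rel ℚ 0ℓ → ℕ → Seq → Seq → Set
Chain R m S T = T ⊆ S × AllPairs R T × length T ≡ m

ChainAbove ChainBelow : Rel ℚ 0ℓ → ℕ → Seq → ℚ → Set
ChainAbove R m S x = ∃[ T ] Chain R m S T × All (x <ℚ_) T
ChainBelow R m S x = ∃[ T ] Chain R m S T × All (_<ℚ x) T

no-new-entry : ∀ {T S : Seq} → T ⊆ S → ¬ Any (_∉ S) T
no-new-entry τ = Allₚ.All¬⇒¬Any (Sublist.All-resp-⊆ τ (All.tabulate (λ w∈S w∉S → w∉S w∈S)))

∉⇒distinct-∷ : ∀ {x S} → Distinct S → x ∉ S → Distinct (x ∷ S)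
∉⇒distinct-∷ distinct x∉ = Allₚ.¬Any⇒All¬ _ x∉ ∷ distinct

∉⇒distinct-∷ʳ : ∀ {x S} → Distinct S → x ∉ S → Distinct (S ++ [ x ])
∉⇒distinct-∷ʳ {S = S} distinct x∉ =
  AllPairsₚ.++⁺ distinct ([] ∷ [])
    (All.map (λ x≢y → (λ y≡x → x≢y (sym y≡x)) ∷ []) (Allₚ.¬Any⇒All¬ S x∉))

module _ {k l S} (sat : Semisaturated (suc k) (suc l) S) {x} (x∉ : x ∉ S) where

  prepend-forces-chain : ChainAbove _<ℚ_ k S x ⊎ ChainBelow ℚ._>_ l S x
  prepend-forces-chain
    with proj₂ sat (x ∷ S) (∉⇒distinct-∷ (proj₁ sat) x∉) (x ∷ʳ ⊆-refl , ℕ.≤-refl)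
  ... | _ , (x ∷ʳ τ , _) , new = ⊥-elim (no-new-entry τ new)
  ... | _ , (refl ∷ τ , inj₁ (refl , x< ∷ T↑)) , _ = inj₁ (_ , (τ , T↑ , refl) , x<)
  ... | _ , (refl ∷ τ , inj₂ (refl , x> ∷ T↓)) , _ = inj₂ (_ , (τ , T↓ , refl) , x>)

  append-forces-chain : ChainBelow _<ℚ_ k S x ⊎ ChainAbove ℚ._>_ l S x
  append-forces-chain
    with proj₂ sat (S ++ [ x ]) (∉⇒distinct-∷ʳ (proj₁ sat) x∉)
                   (Sublist.++⁺ʳ [ x ] ⊆-refl , ℕ.≤-reflexive (sym (length-∷ʳ S)))
  ... | T , (τ , mono) , new with ⊆-∷ʳ⁻ τ
  ...   | inj₁ σ = ⊥-elim (no-new-entry σ new)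
  ...   | inj₂ (T′ , refl , σ) with mono
  ...     | inj₁ (|T| , T↑) =
    let T′↑ , |T′| , T′<x = chain-∷ʳ⁻ T′ T↑ |T| in inj₁ (T′ , (σ , T′↑ , |T′|) , T′<x)
  ...     | inj₂ (|T| , T↓) =
    let T′↓ , |T′| , T′>x = chain-∷ʳ⁻ T′ T↓ |T| in inj₂ (T′ , (σ , T′↓ , |T′|) , T′>x)

module Ranks {S : Seq} (distinct : Distinct S) where

  rank : ℚ → ℕ
  rank x = length (below x S)

  FreshAt : (ℚ → Set) → ℕ → Set
  FreshAt P i = ∃[ x ] x ∉ S × rank x ≡ i × P x

  chainBelow⇒rank>0 : ∀ {R m x} → ChainBelow R (suc m) S x → 0 < rank x
  chainBelow⇒rank>0 (_ ∷ _ , (τ , _ , _) , w<x ∷ _) = List.filter-some (ℚ._<? _) (lookup τ (here w<x))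

  chainAbove⇒rank<length : ∀ {R m x} → ChainAbove R (suc m) S x → rank x < length S
  chainAbove⇒rank<length (_ ∷ _ , (τ , _ , _) , x<w ∷ _) =
    List.filter-notAll (ℚ._<? _) S (lookup τ (here (ℚ.<-asym x<w)))

  chainAbove-lower : ∀ {R m x y} → y ∉ S → rank y ≤ rank x → ChainAbove R m S x → ChainAbove R m S y
  chainAbove-lower {y = y} y∉ ry≤rx (T , chain@(τ , _ , _) , x<T) =
    T , chain , All.tabulate (λ w∈T → y<w (lookup τ w∈T) (All.lookup x<T w∈T))
    where
    y<w : ∀ {w} → w ∈ S → _ <ℚ w → y <ℚ w
    y<w {w} w∈S x<w with ℚ.<-cmp y w
    ... | tri< y<w _ _ = y<w
    ... | tri≈ _ refl _ = ⊥-elim (y∉ w∈S)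
    ... | tri> _ _ w<y = ⊥-elim (ℕ.<⇒≱ (length-below-< w∈S x<w w<y) ry≤rx)

  chainBelow-raise : ∀ {R m x y} → y ∉ S → rank x ≤ rank y → ChainBelow R m S x → ChainBelow R m S y
  chainBelow-raise {y = y} y∉ rx≤ry (T , chain@(τ , _ , _) , T<x) =
    T , chain , All.tabulate (λ w∈T → w<y (lookup τ w∈T) (All.lookup T<x w∈T))
    where
    w<y : ∀ {w} → w ∈ S → w <ℚ _ → w <ℚ y
    w<y {w} w∈S w<x with ℚ.<-cmp w y
    ... | tri< w<y _ _ = w<y
    ... | tri≈ _ refl _ = ⊥-elim (y∉ w∈S)
    ... | tri> _ _ y<w = ⊥-elim (ℕ.<⇒≱ (length-below-< w∈S y<w w<x) rx≤ry)

  module _ {R R′ : Rel ℚ 0ℓ} {m m′}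
           (forced : ∀ {x} → x ∉ S → ChainAbove R (suc m) S x ⊎ ChainBelow R′ (suc m′) S x) where

    forced-crossing : ∃[ i ] FreshAt (ChainAbove R (suc m) S) i × FreshAt (ChainBelow R′ (suc m′) S) (suc i)
    forced-crossing = let i , _ , Fi , Gi+1 = crossing _ _ (length S) fresh-forced F0 ¬Fn in i , Fi , Gi+1
      where
      fresh-forced : ∀ {i} → i ≤ length S →
                     FreshAt (ChainAbove R (suc m) S) i ⊎ FreshAt (ChainBelow R′ (suc m′) S) i
      fresh-forced i≤n with x , x∉ , rx ← fresh-of-rank distinct i≤n with forced x∉
      ... | inj₁ above = inj₁ (x , x∉ , rx , above)
      ... | inj₂ below = inj₂ (x , x∉ , rx , below)
      F0 : FreshAt (ChainAbove R (suc m) S) 0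
      F0 with fresh-forced z≤n
      ... | inj₁ F0 = F0
      ... | inj₂ (_ , _ , rx≡0 , below) = ⊥-elim (ℕ.<⇒≢ (chainBelow⇒rank>0 below) (sym rx≡0))
      ¬Fn : ¬ FreshAt (ChainAbove R (suc m) S) (length S)
      ¬Fn (_ , _ , rx≡n , above) = ℕ.<⇒≢ (chainAbove⇒rank<length above) rx≡n

  module _ {R R′ : Rel ℚ 0ℓ} (R∩R′⇒⊥ : ∀ {x y} → R x y → R′ x y → ⊥) where

    length-opposite-chainsAbove : ∀ {t m m′} → ChainAbove R m S t → ChainAbove R′ m′ S t →
                                  m + m′ ≤ suc (length (above t S))
    length-opposite-chainsAbove {t} (_ , (τ , T↑ , refl) , t<T) (_ , (τ′ , T′↑ , refl) , t<T′) =
      length-opposite-chains R∩R′⇒⊥ (⊆-filter⁺ (t ℚ.<?_) τ t<T) (⊆-filter⁺ (t ℚ.<?_) τ′ t<T′)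
                             T↑ T′↑

    length-opposite-chainsBelow : ∀ {t m m′} → ChainBelow R m S t → ChainBelow R′ m′ S t →
                                  m + m′ ≤ suc (rank t)
    length-opposite-chainsBelow {t} (_ , (τ , T↑ , refl) , T<t) (_ , (τ′ , T′↑ , refl) , T′<t) =
      length-opposite-chains R∩R′⇒⊥ (⊆-filter⁺ (ℚ._<? t) τ T<t) (⊆-filter⁺ (ℚ._<? t) τ′ T′<t)
                             T↑ T′↑

    length-split-chains : ∀ {t m m′ d} → t ∉ S → ChainBelow R m S t → ChainAbove R m′ S t →
                          ∃[ D ] Chain R′ d S D → m + m′ + d ≤ 2 + length S
    length-split-chains {t} t∉ (T₁ , (τ₁ , T₁↑ , refl) , T₁<t) (T₂ , (τ₂ , T₂↑ , refl) , t<T₂)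
                        (D , τ , D↑ , refl) =
      begin
        length T₁ + length T₂ + length D
          ≡⟨ cong (length T₁ + length T₂ +_) (sym (length-below+above D (t∉ ∘ lookup τ))) ⟩
        length T₁ + length T₂ + (length (below t D) + length (above t D))
          ≡⟨ interchange (length T₁) (length T₂) _ _ ⟩
        (length T₁ + length (below t D)) + (length T₂ + length (above t D))
          ≤⟨ ℕ.+-mono-≤ (bound (ℚ._<? t) τ₁ T₁<t T₁↑) (bound (t ℚ.<?_) τ₂ t<T₂ T₂↑) ⟩
        suc (rank t) + suc (length (above t S))
          ≡⟨ cong suc (ℕ.+-suc _ _) ⟩
        2 + (rank t + length (above t S))
          ≡⟨ cong (2 +_) (length-below+above S t∉) ⟩
        2 + length S ∎
      where
      open ℕ.≤-Reasoning
      bound : ∀ {P : Pred ℚ 0ℓ} (P? : Decidable P) {T} → T ⊆ S → All P T → AllPairs R T →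
              length T + length (filter P? D) ≤ suc (length (filter P? S))
      bound P? τ′ PT T↑ = length-opposite-chains R∩R′⇒⊥ (⊆-filter⁺ P? τ′ PT)
        (Sublist.filter⁺ P? P? (λ { refl → id }) τ) T↑ (AllPairsₚ.filter⁺ P? D↑)

    length-sandwiched-chains : ∀ {x₁ x₂ i m m′} → x₁ ∉ S → rank x₁ ≡ i → rank x₂ ≡ suc i →
                               ChainAbove R m S x₁ → ChainAbove R′ m′ S x₁ →
                               ChainBelow R m S x₂ → ChainBelow R′ m′ S x₂ →
                               (m + m′) + (m + m′) ≤ 3 + length S
    length-sandwiched-chains {x₁} {x₂} {i} {m} {m′} x₁∉ rx₁ rx₂ I₂ D₂ I₁ D₁ = begin
      (m + m′) + (m + m′)
        ≤⟨ ℕ.+-mono-≤ (length-opposite-chainsAbove I₂ D₂) (length-opposite-chainsBelow I₁ D₁) ⟩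
      suc (length (above x₁ S)) + suc (rank x₂)
        ≡⟨ cong (λ r → suc (length (above x₁ S)) + suc r) rx₂ ⟩
      suc (length (above x₁ S)) + suc (suc i)
        ≡⟨ shuffle (length (above x₁ S)) i ⟩
      3 + (i + length (above x₁ S))
        ≡⟨ cong (λ r → 3 + (r + length (above x₁ S))) (sym rx₁) ⟩
      3 + (rank x₁ + length (above x₁ S))
        ≡⟨ cong (3 +_) (length-below+above S x₁∉) ⟩
      3 + length S ∎
      where
      open ℕ.≤-Reasoning
      shuffle : ∀ a i → suc a + suc (suc i) ≡ 3 + (i + a)
      shuffle = solve-∀

private
  split-bound : ∀ p q {n} → suc p + suc p + suc q ≤ 2 + n → p + (suc q + p) ≤ n
  split-bound p q {n} le = ℕ.+-cancelˡ-≤ 2 _ _ (subst (_≤ 2 + n) (rearrange p q) le)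
    where
    rearrange : ∀ p q → suc p + suc p + suc q ≡ 2 + (p + (suc q + p))
    rearrange = solve-∀

  sandwich-bound : ∀ p q {n} → (suc p + suc q) + (suc p + suc q) ≤ 3 + n → p + (suc q + p) ≤ n
  sandwich-bound p q {n} le =
    ℕ.+-cancelˡ-≤ 3 _ _ (ℕ.≤-trans (ℕ.m≤m+n _ q) (subst (_≤ 3 + n) (rearrange p q) le))
    where
    rearrange : ∀ p q → (suc p + suc q) + (suc p + suc q) ≡ 3 + (p + (suc q + p)) + q
    rearrange = solve-∀

module _ {p q S} (sat : Semisaturated (2 + p) (2 + q) S) where

  open Ranks (proj₁ sat)

  semisaturated⇒length-bound : p + (suc q + p) ≤ length S ⊎ q + (suc p + q) ≤ length S
  semisaturated⇒length-bound
    with i , (x₁ , x₁∉ , rx₁ , inc-above) , (x₂ , x₂∉ , rx₂ , dec-below@(_ , dec , _))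
           ← forced-crossing (prepend-forces-chain sat)
    with j , (y₁ , y₁∉ , ry₁ , dec-above) , (y₂ , y₂∉ , ry₂ , inc-below@(_ , inc , _))
           ← forced-crossing (swap ∘ append-forces-chain sat)
    with ℕ.<-cmp i j
  ... | tri> _ _ j<i = inj₁ (split-bound p q (length-split-chains ℚ.<-asym y₂∉ inc-below
          (chainAbove-lower y₂∉ (subst₂ _≤_ (sym ry₂) (sym rx₁) j<i) inc-above) (_ , dec)))
  ... | tri< i<j _ _ = inj₂ (split-bound q p (length-split-chains (flip ℚ.<-asym) x₂∉ dec-below
          (chainAbove-lower x₂∉ (subst₂ _≤_ (sym rx₂) (sym ry₁) i<j) dec-above) (_ , inc)))
  ... | tri≈ _ refl _ = inj₁ (sandwich-bound p q (length-sandwiched-chains ℚ.<-asym x₁∉ rx₁ rx₂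
          inc-above (chainAbove-lower x₁∉ (ℕ.≤-reflexive (trans rx₁ (sym ry₁))) dec-above)
          (chainBelow-raise x₂∉ (ℕ.≤-reflexive (trans ry₂ (sym rx₂))) inc-below) dec-below))

-- The rise–fall–rise sequence

-- Where a new entry x lands in A ++ B ++ C: B₁ and B₂ are the parts of B before and after x.
record Cut {X : Set} (x : X) (A B C S₁ S₂ : List X) : Set where
  field
    B₁ B₂   : List X
    B≡      : B ≡ B₁ ++ B₂
    B₁-x-B₂ : B₁ ++ x ∷ B₂ ⊆ S₁ ++ x ∷ S₂
    x-b-C   : ∀ {b} → b ∈ B₂ → x ∷ b ∷ C ⊆ S₁ ++ x ∷ S₂
    A-b-x   : ∀ {b} → b ∈ B₁ → A ++ b ∷ x ∷ [] ⊆ S₁ ++ x ∷ S₂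

module _ {X : Set} {x : X} where

  cut-at-start : ∀ A B C → Cut x A B C [] (A ++ B ++ C)
  cut-at-start A B C = record
    { B₁ = [] ; B₂ = B ; B≡ = refl
    ; B₁-x-B₂ = refl ∷ Sublist.++⁺ˡ A (Sublist.++⁺ʳ C ⊆-refl)
    ; x-b-C = λ b∈B → refl ∷ Sublist.++⁺ˡ A (Sublist.++⁺ (from∈ b∈B) ⊆-refl)
    ; A-b-x = λ () }

  cut-after-B : ∀ {C} S₁ S₂ → Cut x [] [] C S₁ S₂
  cut-after-B S₁ S₂ = record
    { B₁ = [] ; B₂ = [] ; B≡ = refl
    ; B₁-x-B₂ = Sublist.++⁺ˡ S₁ (refl ∷ minimum S₂)
    ; x-b-C = λ () ; A-b-x = λ () }

  cut-∷B : ∀ {b B C S₁ S₂} → Cut x [] B C S₁ S₂ → Cut x [] (b ∷ B) C (b ∷ S₁) S₂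
  cut-∷B {S₁ = S₁} {S₂} c = record
    { B₁ = _ ∷ B₁ ; B₂ = B₂ ; B≡ = cong (_ ∷_) B≡
    ; B₁-x-B₂ = refl ∷ B₁-x-B₂
    ; x-b-C = λ b∈B₂ → _ ∷ʳ x-b-C b∈B₂
    ; A-b-x = λ { (here refl) → refl ∷ Sublist.++⁺ˡ S₁ (refl ∷ minimum S₂)
                ; (there b∈B₁) → _ ∷ʳ A-b-x b∈B₁ } }
    where open Cut c

  cut-∷A : ∀ {a A B C S₁ S₂} → Cut x A B C S₁ S₂ → Cut x (a ∷ A) B C (a ∷ S₁) S₂
  cut-∷A c = record
    { B₁ = B₁ ; B₂ = B₂ ; B≡ = B≡
    ; B₁-x-B₂ = _ ∷ʳ B₁-x-B₂
    ; x-b-C = λ b∈B₂ → _ ∷ʳ x-b-C b∈B₂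
    ; A-b-x = λ b∈B₁ → refl ∷ A-b-x b∈B₁ }
    where open Cut c

  cut : ∀ A {B C} S₁ S₂ → S₁ ++ S₂ ≡ A ++ B ++ C → Cut x A B C S₁ S₂
  cut A           []       _  refl = cut-at-start A _ _
  cut []  {[]}    (s ∷ S₁) S₂ _    = cut-after-B (s ∷ S₁) S₂
  cut []  {_ ∷ _} (s ∷ S₁) S₂ eq with refl , eq′ ← List.∷-injective eq = cut-∷B (cut [] S₁ S₂ eq′)
  cut (a ∷ A)     (s ∷ S₁) S₂ eq with refl , eq′ ← List.∷-injective eq = cut-∷A (cut A S₁ S₂ eq′)

module RiseFallRise {X : Set} {_≺_ : Rel X 0ℓ} (≺-sto : IsStrictTotalOrder _≡_ _≺_)
  {A B C : List X} (A↑ : AllPairs _≺_ A) (B↓ : AllPairs (flip _≺_) B) (C↑ : AllPairs _≺_ C)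
  (A≺B : All (λ a → All (a ≺_) B) A) (A≺C : All (λ a → All (a ≺_) C) A)
  (B≺C : All (λ b → All (b ≺_) C) B)
  (|C|≡|A| : length C ≡ length A)
  where

  open IsStrictTotalOrder ≺-sto using (compare; _<?_; irrefl) renaming (trans to ≺-trans)

  ≺-≢ : ∀ {u v} → u ≺ v → u ≢ v
  ≺-≢ u≺v refl = irrefl refl u≺v

  ⊀∧≢⇒≻ : ∀ {u v} → ¬ u ≺ v → u ≢ v → v ≺ u
  ⊀∧≢⇒≻ {u} {v} u⊀v u≢v with compare u v
  ... | tri< u≺v _ _ = ⊥-elim (u⊀v u≺v)
  ... | tri≈ _ u≡v _ = ⊥-elim (u≢v u≡v)
  ... | tri> _ _ v≺u = v≺u

  distinct : AllPairs _≢_ (A ++ B ++ C)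
  distinct = AllPairsₚ.++⁺ (AllPairs.map ≺-≢ A↑)
    (AllPairsₚ.++⁺ (AllPairs.map (λ v≺u → ≺-≢ v≺u ∘ sym) B↓) (AllPairs.map ≺-≢ C↑)
                   (All.map (All.map ≺-≢) B≺C))
    (All.zipWith (λ (a≺B , a≺C) → Allₚ.++⁺ (All.map ≺-≢ a≺B) (All.map ≺-≢ a≺C)) (A≺B , A≺C))

  Forced : X → List X → Set
  Forced x S′ = ∃[ T ] T ⊆ S′ × x ∈ T ×
    (length T ≡ 2 + length A × AllPairs _≺_ T ⊎ length T ≡ suc (length B) × AllPairs (flip _≺_) T)

  module _ {x} (x∉B : x ∉ B) {S₁ S₂} (c : Cut x A B C S₁ S₂) where

    open Cut c

    rise : ∀ {b} → b ∈ B₂ → x ≺ b → Forced x (S₁ ++ x ∷ S₂)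
    rise b∈B₂ x≺b = x ∷ _ ∷ C , x-b-C b∈B₂ , here refl ,
      inj₁ (cong (2 +_) |C|≡|A| , (x≺b ∷ All.map (≺-trans x≺b) b≺C) ∷ b≺C ∷ C↑)
      where b≺C = All.lookup B≺C (subst (_ ∈_) (sym B≡) (Anyₚ.++⁺ʳ B₁ b∈B₂))

    fall : ∀ {b} → b ∈ B₁ → b ≺ x → Forced x (S₁ ++ x ∷ S₂)
    fall b∈B₁ b≺x = A ++ _ ∷ x ∷ [] , A-b-x b∈B₁ , Anyₚ.++⁺ʳ A (there (here refl)) ,
      inj₁ (List.length-++-comm A (_ ∷ x ∷ []) , AllPairsₚ.++⁺ A↑ ((b≺x ∷ []) ∷ [] ∷ [])
        (All.map (λ a≺B → let a≺b = All.lookup a≺B b∈B in a≺b ∷ ≺-trans a≺b b≺x ∷ []) A≺B))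
      where b∈B = subst (_ ∈_) (sym B≡) (Anyₚ.++⁺ˡ b∈B₁)

    b≢x : ∀ {b} → b ∈ B₁ ++ B₂ → b ≢ x
    b≢x b∈ refl = x∉B (subst (_ ∈_) (sym B≡) b∈)

    through : All (x ≺_) B₁ → All (_≺ x) B₂ → Forced x (S₁ ++ x ∷ S₂)
    through x≺B₁ B₂≺x with AllPairs-++⁻ B₁ (subst (AllPairs (flip _≺_)) B≡ B↓)
    ... | B₁↓ , B₂↓ , B₁≻B₂ = B₁ ++ x ∷ B₂ , B₁-x-B₂ , Anyₚ.++⁺ʳ B₁ (here refl) ,
      inj₂ ( trans (List.length-++-sucʳ B₁ x B₂) (cong (suc ∘ length) (sym B≡))
           , AllPairsₚ.++⁺ B₁↓ (B₂≺x ∷ B₂↓)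
               (All.zipWith (λ (x≺b , b≻B₂) → x≺b ∷ b≻B₂) (x≺B₁ , B₁≻B₂)))

    forced : Forced x (S₁ ++ x ∷ S₂)
    forced with any? (x <?_) B₂
    ... | yes x≺B₂ = let _ , b∈B₂ , x≺b = find x≺B₂ in rise b∈B₂ x≺b
    ... | no x⊀B₂ with any? (_<? x) B₁
    ...   | yes B₁≺x = let _ , b∈B₁ , b≺x = find B₁≺x in fall b∈B₁ b≺x
    ...   | no B₁⊀x = through
      (All.tabulate λ b∈B₁ → ⊀∧≢⇒≻ (B₁⊀x ∘ lose b∈B₁) (b≢x (Anyₚ.++⁺ˡ b∈B₁)))
      (All.tabulate λ b∈B₂ → ⊀∧≢⇒≻ (x⊀B₂ ∘ lose b∈B₂) (b≢x (Anyₚ.++⁺ʳ B₁ b∈B₂) ∘ sym))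

  insertion-forced : ∀ {x} S₁ S₂ → S₁ ++ S₂ ≡ A ++ B ++ C → x ∉ A ++ B ++ C →
                     Forced x (S₁ ++ x ∷ S₂)
  insertion-forced S₁ S₂ eq x∉ = forced (x∉ ∘ Anyₚ.++⁺ʳ A ∘ Anyₚ.++⁺ˡ) (cut A S₁ S₂ eq)

insertion⇒semisaturated : ∀ {k l S} → Distinct S →
  (∀ S₁ S₂ {x} → S₁ ++ S₂ ≡ S → x ∉ S →
     ∃[ T ] T ⊆ S₁ ++ x ∷ S₂ × x ∈ T × (length T ≡ k × Increasing T ⊎ length T ≡ l × Decreasing T)) →
  Semisaturated k l S
insertion⇒semisaturated distinct forced = distinct , λ S′ distinct′ (τ , |S|<|S′|) →
  let S₁ , x , S₂ , S≡ , σ = proper-sublist⇒insertion τ |S|<|S′|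
      x∉ = subst (x ∉_) (sym S≡) (distinct-middle-∉ S₁ (AllPairs-resp-⊆ σ distinct′))
      T , T⊆ , x∈T , mono = forced S₁ S₂ (sym S≡) x∉
  in T , (⊆-trans T⊆ σ , mono) , Any.map (λ { refl → x∉ }) x∈T

module IndexedRiseFallRise {_≺_ : Rel ℚ 0ℓ} (≺-sto : IsStrictTotalOrder _≡_ _≺_)
                 {e : ℕ → ℚ} (e-mono : ∀ {i j} → i < j → e i ≺ e j) (a m : ℕ) where

  A B C : Seq
  A = applyUpTo e a
  B = applyDownFrom (e ∘ (a +_)) m
  C = applyUpTo (e ∘ (a + m +_)) a

  private
    Before After : ℕ → ℚ → Set
    Before n u = ∃[ i ] i < n × u ≡ e i
    After  n u = ∃[ i ] n ≤ i × u ≡ e i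

    separated : ∀ {n U V} → (∀ {u} → u ∈ U → Before n u) → (∀ {v} → v ∈ V → After n v) →
                All (λ u → All (u ≺_) V) U
    separated before after = All.tabulate λ u∈U → All.tabulate λ v∈V →
      let i , i<n , u≡ = before u∈U ; j , n≤j , v≡ = after v∈V
      in subst₂ _≺_ (sym u≡) (sym v≡) (e-mono (ℕ.<-≤-trans i<n n≤j))

    A-before : ∀ {u} → u ∈ A → Before a u
    A-before = ∈-applyUpTo⁻ e

    B-after : ∀ {u} → u ∈ B → After a u
    B-after u∈B = let j , _ , u≡ = ∈-applyDownFrom⁻ (e ∘ (a +_)) u∈B in a + j , ℕ.m≤m+n a j , u≡

    B-before : ∀ {u} → u ∈ B → Before (a + m) u
    B-before u∈B =
      let j , j<m , u≡ = ∈-applyDownFrom⁻ (e ∘ (a +_)) u∈B in a + j , ℕ.+-monoʳ-< a j<m , u≡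

    C-after : ∀ n → n ≤ a + m → ∀ {u} → u ∈ C → After n u
    C-after n n≤ u∈C =
      let j , _ , u≡ = ∈-applyUpTo⁻ (e ∘ (a + m +_)) u∈C in a + m + j , ℕ.≤-trans n≤ (ℕ.m≤m+n _ j) , u≡

  open RiseFallRise ≺-sto
    (AllPairsₚ.applyUpTo⁺₁ e a (λ i<j _ → e-mono i<j))
    (AllPairsₚ.applyDownFrom⁺₁ (e ∘ (a +_)) m (λ j<i _ → e-mono (ℕ.+-monoʳ-< a j<i)))
    (AllPairsₚ.applyUpTo⁺₁ (e ∘ (a + m +_)) a (λ i<j _ → e-mono (ℕ.+-monoʳ-< (a + m) i<j)))
    (separated A-before B-after) (separated A-before (C-after a (ℕ.m≤m+n a m)))
    (separated B-before (C-after (a + m) ℕ.≤-refl))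
    (trans (List.length-applyUpTo _ a) (sym (List.length-applyUpTo e a)))
    public

  |A| : length A ≡ a
  |A| = List.length-applyUpTo e a

  |B| : length B ≡ m
  |B| = List.length-applyDownFrom (e ∘ (a +_)) m

  |A++B++C| : length (A ++ B ++ C) ≡ a + (m + a)
  |A++B++C| = trans (List.length-++ A)
    (cong₂ _+_ |A| (trans (List.length-++ B) (cong₂ _+_ |B| (List.length-applyUpTo _ a))))

  forced-chain : ∀ S₁ S₂ {x} → S₁ ++ S₂ ≡ A ++ B ++ C → x ∉ A ++ B ++ C →
                 ∃[ T ] T ⊆ S₁ ++ x ∷ S₂ × x ∈ T ×
                   (length T ≡ 2 + a × AllPairs _≺_ T ⊎ length T ≡ suc m × AllPairs (flip _≺_) T)
  forced-chain S₁ S₂ eq x∉ with T , τ , x∈T , mono ← insertion-forced S₁ S₂ eq x∉ =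
    T , τ , x∈T ,
    Sum.map (Prod.map₁ (λ |T| → trans |T| (cong (2 +_) |A|))) (Prod.map₁ (λ |T| → trans |T| (cong suc |B|))) mono

ℕ→ℚ : ℕ → ℚ
ℕ→ℚ zero    = 0ℚ
ℕ→ℚ (suc n) = ℕ→ℚ n ℚ.+ 1ℚ

ℕ→ℚ-mono-< : ∀ {i j} → i < j → ℕ→ℚ i <ℚ ℕ→ℚ j
ℕ→ℚ-mono-< {i} {suc j} (s≤s i≤j) with ℕ.m≤n⇒m<n∨m≡n i≤j
... | inj₁ i<j  = ℚ.<-trans (ℕ→ℚ-mono-< i<j) (p<p+1 (ℕ→ℚ j))
... | inj₂ refl = p<p+1 (ℕ→ℚ j)

riseFallRise-semisaturated : ∀ a m → ∃[ S ] Semisaturated (2 + a) (suc m) S × length S ≡ a + (m + a)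
riseFallRise-semisaturated a m = A ++ B ++ C , insertion⇒semisaturated distinct forced-chain , |A++B++C|
  where open IndexedRiseFallRise ℚ.<-isStrictTotalOrder ℕ→ℚ-mono-< a m

fallRiseFall-semisaturated : ∀ a m → ∃[ S ] Semisaturated (suc m) (2 + a) S × length S ≡ a + (m + a)
fallRiseFall-semisaturated a m =
  A ++ B ++ C ,
  insertion⇒semisaturated distinct (λ S₁ S₂ eq x∉ → Prod.map₂ (Prod.map₂ (Prod.map₂ swap)) (forced-chain S₁ S₂ eq x∉)) ,
  |A++B++C|
  where
  open IndexedRiseFallRise (Flip.isStrictTotalOrder ℚ.<-isStrictTotalOrder) (ℚ.neg-antimono-< ∘ ℕ→ℚ-mono-<) a m

osat-trivial : ∀ {k l} → k ≡ 1 ⊎ l ≡ 1 → OsatIs k l 0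
osat-trivial {k} {l} k≡1⊎l≡1 = ([] , ([] , extend) , refl) , λ _ _ → z≤n
  where
  singleton : ∀ y → length [ y ] ≡ k × Increasing [ y ] ⊎ length [ y ] ≡ l × Decreasing [ y ]
  singleton y = Sum.map (λ k≡1 → sym k≡1 , [] ∷ []) (λ l≡1 → sym l≡1 , [] ∷ []) k≡1⊎l≡1
  extend : ∀ S′ → Distinct S′ → [] ⊂ S′ → ∃[ T ] MonoSub k l S′ T × Any (_∉ []) T
  extend []       _ (_ , ())
  extend (y ∷ S′) _ _ = [ y ] , (refl ∷ minimum S′ , singleton y) , here λ ()

osat-⊓ : ∀ {k l m n} →
         ∃[ S ] Semisaturated k l S × length S ≡ m → ∃[ S ] Semisaturated k l S × length S ≡ n →
         (∀ S → Semisaturated k l S → m ⊓ n ≤ length S) → OsatIs k l (m ⊓ n)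
osat-⊓ {m = m} {n} witnessₘ witnessₙ bound with ℕ.⊓-sel m n
... | inj₁ m⊓n≡m = Prod.map₂ (Prod.map₂ (λ |S| → trans |S| (sym m⊓n≡m))) witnessₘ , bound
... | inj₂ m⊓n≡n = Prod.map₂ (Prod.map₂ (λ |S| → trans |S| (sym m⊓n≡n))) witnessₙ , bound

osat-formula : ∀ p q → 2 * (2 + p) + (2 + q) ∸ 5 ≡ p + (suc q + p)
osat-formula p q = trans (cong (_∸ 5) (expand p q)) (ℕ.m+n∸m≡n 5 _)
  where
  expand : ∀ p q → 2 * (2 + p) + (2 + q) ≡ 5 + (p + (suc q + p))
  expand = solve-∀

theorem6 : ((k l : ℕ) → 1 ≤ k → 1 ≤ l → OsatIs 1 l 0 × OsatIs k 1 0)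
    × ((k l : ℕ) → 2 ≤ k → 2 ≤ l →
         OsatIs k l ((2 * k + l ∸ 5) ⊓ (2 * l + k ∸ 5)))
theorem6 = (λ _ _ _ _ → osat-trivial (inj₁ refl) , osat-trivial (inj₂ refl)) , osat-≥2
  where
  osat-≥2 : (k l : ℕ) → 2 ≤ k → 2 ≤ l → OsatIs k l ((2 * k + l ∸ 5) ⊓ (2 * l + k ∸ 5))
  osat-≥2 (suc (suc p)) (suc (suc q)) (s≤s (s≤s _)) (s≤s (s≤s _)) =
    subst (OsatIs (2 + p) (2 + q)) (sym (cong₂ _⊓_ (osat-formula p q) (osat-formula q p)))
      (osat-⊓ (riseFallRise-semisaturated p (suc q)) (fallRiseFall-semisaturated q (suc p))
        λ _ sat → Sum.[ ℕ.≤-trans (ℕ.m⊓n≤m _ _) , ℕ.≤-trans (ℕ.m⊓n≤n _ _) ]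
                        (semisaturated⇒length-bound sat))
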